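{- Fix an integer $\sigma\ge2$ and let $\mu=1/\sigma$. For $w$ large, let $d=\lfloor\log_\sigma(w/\ln w)\rfloor-1$, let $A_d$ be the $d\times d$ matrix whose first row is $(1-\mu,\dots,1-\mu)$, whose subdiagonal entries $(A_d)_{i+1,i}$ ($1\le i\le d-1$) equal $\mu$, and all of whose other entries are $0$, and let $p_0=(1,0,\dots,0)^T\in\mathbb{R}^d$. Then $\|A_d^w p_0\|_1=O(1/w)$ as $w\to\infty$.
   Context: Interpretation (not needed for the statement): $\|A_d^wp_0\|_1$ equals the fraction of $w$-mers over $\{0,\dots,\sigma-1\}$ that do not contain $d$ consecutive zeros. -}

module Defs where

open import Data.Nat as ℕ using (ℕ; zero; suc; _^_; _≤_)
open import Data.Nat using (_!)
open import Data.Integer using (+_)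
open import Data.Rational using (ℚ; 0ℚ; 1ℚ; _/_; _+_; _*_; _-_; ∣_∣)
open import Data.Fin using (Fin; zero; suc; toℕ)
open import Data.Product using (∃-syntax; _×_)
open import Relation.Nullary using (yes; no)

ℕ→ℚ : ℕ → ℚ
ℕ→ℚ n = + n / 1

-- μ = 1/σ  (the value at σ = 0 is junk; σ ≥ 2 is assumed in the statement)
μ : ℕ → ℚ
μ zero = 0ℚ
μ (suc n) = + 1 / suc n

A : (σ d : ℕ) → Fin d → Fin d → ℚ
A σ d zero j = 1ℚ - μ σ
A σ d (suc i) j with toℕ i ℕ.≟ toℕ j
... | yes _ = μ σ
... | no _ = 0ℚ

p₀ : (d : ℕ) → Fin d → ℚ
p₀ d zero = 1ℚ
p₀ d (suc i) = 0ℚ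

sumFin : (d : ℕ) → (Fin d → ℚ) → ℚ
sumFin zero f = 0ℚ
sumFin (suc d) f = f zero + sumFin d (λ i → f (suc i))

_·ᵥ_ : {d : ℕ} → (Fin d → Fin d → ℚ) → (Fin d → ℚ) → Fin d → ℚ
_·ᵥ_ {d} M v i = sumFin d (λ j → M i j * v j)

pow·ᵥ : {d : ℕ} → (Fin d → Fin d → ℚ) → ℕ → (Fin d → ℚ) → Fin d → ℚ
pow·ᵥ M zero v = v
pow·ᵥ M (suc w) v = M ·ᵥ pow·ᵥ M w v

‖_‖₁ : {d : ℕ} → (Fin d → ℚ) → ℚ
‖_‖₁ {d} v = sumFin d (λ i → ∣ v i ∣)

-- S w N = N! · Σ_{n=0}^{N} w^n / n!   (scaled partial sums of the series of e^w)
S : ℕ → ℕ → ℕ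
S w zero = 1
S w (suc N) = suc N ℕ.* S w N ℕ.+ w ^ suc N

-- "x ≤ e^w" : some partial sum of e^w is ≥ x
-- (for w ≥ 1, e^w is irrational, so this is exactly x ≤ e^w)
LeExp : ℕ → ℕ → Set
LeExp x w = ∃[ N ] x ℕ.* (N !) ≤ S w N

-- "e^w < x" : all partial sums of e^w are ≤ x
-- (for w ≥ 1, e^w is irrational, so this is exactly e^w < x)
ExpLt : ℕ → ℕ → Set
ExpLt w x = (N : ℕ) → S w N ≤ x ℕ.* (N !)

-- IsD σ w d  ⟺  d = ⌊log_σ (w / ln w)⌋ - 1   (for w ≥ 2), i.e.
--   σ^(d+1) ≤ w / ln w < σ^(d+2)
-- ⟺ σ^(d+1) · ln w ≤ w  and  w < σ^(d+2) · ln w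
-- ⟺ w^(σ^(d+1)) ≤ e^w  and  e^w < w^(σ^(d+2)).
IsD : (σ w d : ℕ) → Set
IsD σ w d = LeExp (w ^ (σ ^ suc d)) w × ExpLt w (w ^ (σ ^ suc (suc d)))

{-# OPTIONS --safe #-}
module Submission where

-- Write σ = k + 1. The vectors σᵗ A_dᵗ p₀ are integer vectors q_t, so the quantity to bound is
-- w T_w / σʷ with T_t = Σᵢ q_t(i). With D = σᵈ, the potential Ψ_t = Σᵢ (D − σⁱ) q_t(i) satisfies
-- Ψ_{t+1} + k T_t = σ Ψ_t; since Ψ_t ≤ D T_t this gives D Ψ_{t+1} ≤ (σD − 1) Ψ_t, and together with
-- k σ^(d−1) T_t ≤ Ψ_t and Ψ_0 ≤ D it yields k w T_w ≤ σ^(w+1) · w (1 − 1/(σD))ʷ. Finally the choice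
-- of d gives w^(σD) ≤ eʷ, which forces w (1 − 1/m)ʷ ≤ 1 for m = σD because every partial sum of eʷ
-- is at most (1 + 1/(m − 1))^(m w). Hence w ‖A_dʷ p₀‖₁ = w T_w / σʷ ≤ σ / k ≤ 2.

open import Data.Nat using (ℕ)

module ExponentialBound where

  open import Data.Nat
  open import Data.Nat.Properties
  open import Data.Nat.Solver using (module +-*-Solver)
  open +-*-Solver
  open import Algebra.Properties.CommutativeSemigroup *-commutativeSemigroup
    using (interchange; x∙yz≈y∙xz; xy∙z≈y∙xz)
  open import Data.Product using (_,_)
  open import Relation.Binary.PropositionalEquality
  open import Defs using (S; LeExp)

  ^-distribʳ-* : ∀ m n k → (m * n) ^ k ≡ m ^ k * n ^ k
  ^-distribʳ-* m n zero    = refl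
  ^-distribʳ-* m n (suc k) =
    trans (cong (m * n *_) (^-distribʳ-* m n k)) (interchange m n (m ^ k) (n ^ k))

  ^-cancelʳ-≤ : ∀ k {a b} → a ^ suc k ≤ b ^ suc k → a ≤ b
  ^-cancelʳ-≤ k aᵏ≤bᵏ = ≮⇒≥ (λ b<a → <⇒≱ (^-monoˡ-< (suc k) b<a) aᵏ≤bᵏ)

  [1+x]^[1+k]-increment : ∀ x k → suc x ^ suc k ≤ x ^ suc k + suc k * suc x ^ k
  [1+x]^[1+k]-increment x zero = ≤-reflexive (+-comm 1 (x * 1))
  [1+x]^[1+k]-increment x (suc k) = begin
      suc x * suc x ^ suc k
    ≤⟨ *-monoʳ-≤ (suc x) ([1+x]^[1+k]-increment x k) ⟩
      suc x * (xᵏ⁺¹ + suc k * suc x ^ k)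
    ≡⟨ solve 4 (λ x a k b → (con 1 :+ x) :* (a :+ (con 1 :+ k) :* b)
                          := x :* a :+ a :+ (con 1 :+ k) :* ((con 1 :+ x) :* b))
             refl x xᵏ⁺¹ k (suc x ^ k) ⟩
      x * xᵏ⁺¹ + xᵏ⁺¹ + suc k * (suc x * suc x ^ k)
    ≤⟨ +-monoˡ-≤ _ (+-monoʳ-≤ (x * xᵏ⁺¹) (^-monoˡ-≤ (suc k) (n≤1+n x))) ⟩
      x * xᵏ⁺¹ + suc x ^ suc k + suc k * suc x ^ suc k
    ≡⟨ +-assoc (x * xᵏ⁺¹) _ _ ⟩
      x ^ suc (suc k) + suc (suc k) * suc x ^ suc k
    ∎
    where
      open ≤-Reasoning
      xᵏ⁺¹ = x ^ suc k

  -- homS n N x = N! Σ_{i ≤ N} n^(N−i) xⁱ / i!, a homogenised S.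
  homS : ℕ → ℕ → ℕ → ℕ
  homS n zero    x = 1
  homS n (suc N) x = n * suc N * homS n N x + x ^ suc N

  homS-scale : ∀ n N w → homS n N (n * w) ≡ n ^ N * S w N
  homS-scale n zero    w = refl
  homS-scale n (suc N) w rewrite homS-scale n N w | ^-distribʳ-* n w (suc N) =
    solve 5 (λ n N a s b → n :* (con 1 :+ N) :* (a :* s) :+ n :* a :* b
                        := n :* a :* ((con 1 :+ N) :* s :+ b))
          refl n N (n ^ N) (S w N) (w ^ suc N)

  homS-zero : ∀ n N → homS n N 0 ≡ n ^ N * N !
  homS-zero n zero    = refl
  homS-zero n (suc N) rewrite homS-zero n N =
    solve 4 (λ n N a f → n :* (con 1 :+ N) :* (a :* f) :+ con 0 := n :* a :* ((con 1 :+ N) :* f))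
          refl n N (n ^ N) (N !)

  homS-increment : ∀ n N x → homS n (suc N) (suc x) ≤ homS n (suc N) x + suc N * homS n N (suc x)
  homS-increment n zero x = ≤-reflexive
    (solve 2 (λ n x → n :* con 1 :* con 1 :+ (con 1 :+ x) :* con 1
                   := n :* con 1 :* con 1 :+ x :* con 1 :+ con 1 :* con 1) refl n x)
  homS-increment n (suc N) x = begin
      n * suc (suc N) * homS n (suc N) (suc x) + suc x ^ suc (suc N)
    ≤⟨ +-mono-≤ (*-monoʳ-≤ (n * suc (suc N)) (homS-increment n N x))
                ([1+x]^[1+k]-increment x (suc N)) ⟩
      n * suc (suc N) * (homS n (suc N) x + suc N * homS n N (suc x))
        + (x ^ suc (suc N) + suc (suc N) * suc x ^ suc N)
    ≡⟨ solve 6 (λ n N a b c d → n :* (con 2 :+ N) :* (a :+ (con 1 :+ N) :* b) :+ (c :+ (con 2 :+ N) :* d)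
                             := (n :* (con 2 :+ N) :* a :+ c) :+ (con 2 :+ N) :* (n :* (con 1 :+ N) :* b :+ d))
             refl n N (homS n (suc N) x) (homS n N (suc x)) (x ^ suc (suc N)) (suc x ^ suc N) ⟩
      homS n (suc (suc N)) x + suc (suc N) * homS n (suc N) (suc x)
    ∎
    where open ≤-Reasoning

  -- homS-increment bounds the x-derivative of homS n (1 + N) by (1 + N) · homS n N, which is at most
  -- homS n (1 + N) / n; so a unit step in x multiplies homS by at most n / (n − 1).
  homS-ratio : ∀ m N x → m * homS (suc m) N (suc x) ≤ suc m * homS (suc m) N x
  homS-ratio m zero    x = *-monoˡ-≤ 1 (n≤1+n m)
  homS-ratio m (suc N) x = +-cancelˡ-≤ A (m * A) (suc m * homS (suc m) (suc N) x) (begin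
      suc m * A
    ≤⟨ *-monoʳ-≤ (suc m) (homS-increment (suc m) N x) ⟩
      suc m * (homS (suc m) (suc N) x + suc N * B)
    ≡⟨ solve 4 (λ m a N b → (con 1 :+ m) :* (a :+ (con 1 :+ N) :* b)
                         := (con 1 :+ m) :* (con 1 :+ N) :* b :+ (con 1 :+ m) :* a)
             refl m (homS (suc m) (suc N) x) N B ⟩
      suc m * suc N * B + suc m * homS (suc m) (suc N) x
    ≤⟨ +-monoˡ-≤ _ (m≤m+n (suc m * suc N * B) (suc x ^ suc N)) ⟩
      A + suc m * homS (suc m) (suc N) x
    ∎)
    where
      open ≤-Reasoning
      A = homS (suc m) (suc N) (suc x)
      B = homS (suc m) N (suc x)

  homS-iterate : ∀ m N x → m ^ x * homS (suc m) N x ≤ suc m ^ x * homS (suc m) N 0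
  homS-iterate m N zero    = ≤-refl
  homS-iterate m N (suc x) = begin
      m * m ^ x * homS (suc m) N (suc x)
    ≡⟨ xy∙z≈y∙xz m (m ^ x) _ ⟩
      m ^ x * (m * homS (suc m) N (suc x))
    ≤⟨ *-monoʳ-≤ (m ^ x) (homS-ratio m N x) ⟩
      m ^ x * (suc m * homS (suc m) N x)
    ≡⟨ x∙yz≈y∙xz (m ^ x) (suc m) _ ⟩
      suc m * (m ^ x * homS (suc m) N x)
    ≤⟨ *-monoʳ-≤ (suc m) (homS-iterate m N x) ⟩
      suc m * (suc m ^ x * homS (suc m) N 0)
    ≡⟨ *-assoc (suc m) (suc m ^ x) _ ⟨
      suc m * suc m ^ x * homS (suc m) N 0
    ∎
    where open ≤-Reasoning

  S-bound : ∀ m w N → m ^ (suc m * w) * S w N ≤ suc m ^ (suc m * w) * N !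
  S-bound m w N = *-cancelˡ-≤ (suc m ^ N) {{m^n≢0 (suc m) N}} (begin
      suc m ^ N * (m ^ K * S w N)
    ≡⟨ x∙yz≈y∙xz (suc m ^ N) (m ^ K) (S w N) ⟩
      m ^ K * (suc m ^ N * S w N)
    ≡⟨ cong (m ^ K *_) (homS-scale (suc m) N w) ⟨
      m ^ K * homS (suc m) N K
    ≤⟨ homS-iterate m N K ⟩
      suc m ^ K * homS (suc m) N 0
    ≡⟨ cong (suc m ^ K *_) (homS-zero (suc m) N) ⟩
      suc m ^ K * (suc m ^ N * N !)
    ≡⟨ x∙yz≈y∙xz (suc m ^ K) (suc m ^ N) (N !) ⟩
      suc m ^ N * (suc m ^ K * N !)
    ∎)
    where
      open ≤-Reasoning
      K = suc m * w

  LeExp⇒w*[m∸1]^w≤m^w : ∀ m w .{{_ : NonZero m}} → LeExp (w ^ m) w → w * (m ∸ 1) ^ w ≤ m ^ w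
  LeExp⇒w*[m∸1]^w≤m^w (suc m) w (N , wᵐ⁺¹≤eʷ) =
    ^-cancelʳ-≤ m (*-cancelʳ-≤ _ _ (N !) {{N !≢0}} (begin
      (w * m ^ w) ^ suc m * N !
    ≡⟨ cong (_* N !) (power-of-product w m) ⟩
      w ^ suc m * m ^ (suc m * w) * N !
    ≡⟨ xy∙z≈y∙xz (w ^ suc m) (m ^ (suc m * w)) (N !) ⟩
      m ^ (suc m * w) * (w ^ suc m * N !)
    ≤⟨ *-monoʳ-≤ (m ^ (suc m * w)) wᵐ⁺¹≤eʷ ⟩
      m ^ (suc m * w) * S w N
    ≤⟨ S-bound m w N ⟩
      suc m ^ (suc m * w) * N !
    ≡⟨ cong (_* N !) (power-of-power (suc m)) ⟨
      (suc m ^ w) ^ suc m * N !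
    ∎))
    where
      open ≤-Reasoning
      power-of-power : ∀ a → (a ^ w) ^ suc m ≡ a ^ (suc m * w)
      power-of-power a = trans (^-*-assoc a w (suc m)) (cong (a ^_) (*-comm w (suc m)))
      power-of-product : ∀ a b → (a * b ^ w) ^ suc m ≡ a ^ suc m * b ^ (suc m * w)
      power-of-product a b =
        trans (^-distribʳ-* a (b ^ w) (suc m)) (cong (a ^ suc m *_) (power-of-power b))

module ZeroRuns (k : ℕ) where

  open import Data.Nat
  open import Data.Nat.Properties
  open import Data.Nat.Solver using (module +-*-Solver)
  open +-*-Solver
  open import Data.Fin using (Fin; zero; suc; toℕ; inject₁; fromℕ)
  open import Data.Fin.Properties using (toℕ-inject₁; toℕ-fromℕ; toℕ<n)
  open import Algebra.Properties.Semiring.Sum +-*-semiring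
    using (sum; sum-cong-≗; ∑-distrib-+; *-distribˡ-sum; sum-init-last; sum-replicate-zero)
  open import Algebra.Properties.CommutativeSemigroup *-commutativeSemigroup
    using (x∙yz≈y∙xz; x∙yz≈yx∙z; xy∙z≈y∙xz)
  open import Relation.Binary.PropositionalEquality
  open import Defs using (LeExp)
  open ExponentialBound using (^-distribʳ-*; LeExp⇒w*[m∸1]^w≤m^w)

  sum-mono-≤ : ∀ {d} {f g : Fin d → ℕ} → (∀ i → f i ≤ g i) → sum f ≤ sum g
  sum-mono-≤ {zero}  f≤g = ≤-refl
  sum-mono-≤ {suc d} f≤g = +-mono-≤ (f≤g zero) (sum-mono-≤ (λ i → f≤g (suc i)))

  σ : ℕ
  σ = suc k

  -- runs t i counts the words of length t over σ letters that contain no d consecutive zeros and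
  -- end in exactly i zeros.
  runs : ∀ {d} → ℕ → Fin d → ℕ
  runs zero    zero    = 1
  runs zero    (suc i) = 0
  runs {suc d} (suc t) zero    = k * sum (runs {suc d} t)
  runs         (suc t) (suc i) = runs t (inject₁ i)

  total : ℕ → ℕ → ℕ
  total d t = sum (runs {d} t)

  module Potential (n : ℕ) where

    q : ℕ → Fin (suc n) → ℕ
    q = runs

    T : ℕ → ℕ
    T = total (suc n)

    D : ℕ
    D = σ ^ suc n

    instance
      D≢0 : NonZero D
      D≢0 = m^n≢0 σ (suc n)

    weighted potential : ℕ → ℕ
    weighted  t = sum (λ j → σ ^ toℕ j * q t j)
    potential t = sum (λ j → (D ∸ σ ^ toℕ j) * q t j)

    last : ℕ → ℕ
    last t = q t (fromℕ n)

    potential+weighted : ∀ t → potential t + weighted t ≡ D * T t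
    potential+weighted t = begin
        potential t + weighted t
      ≡⟨ ∑-distrib-+ (λ j → (D ∸ σ ^ toℕ j) * q t j) (λ j → σ ^ toℕ j * q t j) ⟨
        sum (λ j → (D ∸ σ ^ toℕ j) * q t j + σ ^ toℕ j * q t j)
      ≡⟨ sum-cong-≗ (λ j → trans (sym (*-distribʳ-+ (q t j) (D ∸ σ ^ toℕ j) (σ ^ toℕ j)))
                             (cong (_* q t j) (m∸n+n≡m (^-monoʳ-≤ σ (<⇒≤ (toℕ<n j)))))) ⟩
        sum (λ j → D * q t j)
      ≡⟨ *-distribˡ-sum D (q t) ⟨
        D * T t
      ∎
      where open ≡-Reasoning

    weighted≤ : ∀ t → weighted t ≤ σ ^ n * T t
    weighted≤ t = begin
        weighted t
      ≤⟨ sum-mono-≤ (λ j → *-monoˡ-≤ (q t j) (^-monoʳ-≤ σ (≤-pred (toℕ<n j)))) ⟩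
        sum (λ j → σ ^ n * q t j)
      ≡⟨ *-distribˡ-sum (σ ^ n) (q t) ⟨
        σ ^ n * T t
      ∎
      where open ≤-Reasoning

    total-step : ∀ t → T (suc t) + last t ≡ σ * T t
    total-step t = begin
        k * T t + sum (λ i → q t (inject₁ i)) + last t
      ≡⟨ +-assoc (k * T t) _ _ ⟩
        k * T t + (sum (λ i → q t (inject₁ i)) + last t)
      ≡⟨ cong (k * T t +_) (sum-init-last (q t)) ⟨
        k * T t + T t
      ≡⟨ +-comm (k * T t) (T t) ⟩
        σ * T t
      ∎
      where open ≡-Reasoning

    weighted-init : ℕ → ℕ
    weighted-init t = sum (λ i → σ ^ toℕ i * q t (inject₁ i))

    weighted-init-last : ∀ t → weighted t ≡ weighted-init t + σ ^ n * last t
    weighted-init-last t = trans (sum-init-last (λ j → σ ^ toℕ j * q t j))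
      (cong₂ _+_ (sum-cong-≗ (λ i → cong (λ m → σ ^ m * q t (inject₁ i)) (toℕ-inject₁ i)))
                 (cong (λ m → σ ^ m * last t) (toℕ-fromℕ n)))

    weighted-step : ∀ t → weighted (suc t) + D * last t ≡ k * T t + σ * weighted t
    weighted-step t = begin
        1 * (k * T t) + sum (λ i → σ * σ ^ toℕ i * q t (inject₁ i)) + D * last t
      ≡⟨ cong (λ m → 1 * (k * T t) + m + D * last t)
              (trans (sum-cong-≗ (λ i → *-assoc σ (σ ^ toℕ i) (q t (inject₁ i))))
                     (sym (*-distribˡ-sum σ (λ i → σ ^ toℕ i * q t (inject₁ i))))) ⟩
        1 * (k * T t) + σ * weighted-init t + σ * σ ^ n * last t
      ≡⟨ solve 5 (λ kT σ g p l → con 1 :* kT :+ σ :* g :+ σ :* p :* l := kT :+ σ :* (g :+ p :* l))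
               refl (k * T t) σ (weighted-init t) (σ ^ n) (last t) ⟩
        k * T t + σ * (weighted-init t + σ ^ n * last t)
      ≡⟨ cong (λ m → k * T t + σ * m) (weighted-init-last t) ⟨
        k * T t + σ * weighted t
      ∎
      where open ≡-Reasoning

    potential-step : ∀ t → potential (suc t) + k * T t ≡ σ * potential t
    potential-step t = +-cancelʳ-≡ (weighted (suc t) + D * last t) _ _ (begin
        potential (suc t) + k * T t + (weighted (suc t) + D * last t)
      ≡⟨ solve 4 (λ ψ kT g dl → ψ :+ kT :+ (g :+ dl) := ψ :+ g :+ dl :+ kT)
               refl (potential (suc t)) (k * T t) (weighted (suc t)) (D * last t) ⟩
        potential (suc t) + weighted (suc t) + D * last t + k * T t
      ≡⟨ cong (λ m → m + D * last t + k * T t) (potential+weighted (suc t)) ⟩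
        D * T (suc t) + D * last t + k * T t
      ≡⟨ cong (_+ k * T t) (trans (sym (*-distribˡ-+ D (T (suc t)) (last t)))
                                  (cong (D *_) (total-step t))) ⟩
        D * (σ * T t) + k * T t
      ≡⟨ cong (_+ k * T t) (x∙yz≈y∙xz D σ (T t)) ⟩
        σ * (D * T t) + k * T t
      ≡⟨ cong (λ m → σ * m + k * T t) (potential+weighted t) ⟨
        σ * (potential t + weighted t) + k * T t
      ≡⟨ solve 4 (λ σ ψ g kT → σ :* (ψ :+ g) :+ kT := σ :* ψ :+ (kT :+ σ :* g))
               refl σ (potential t) (weighted t) (k * T t) ⟩
        σ * potential t + (k * T t + σ * weighted t)
      ≡⟨ cong (σ * potential t +_) (weighted-step t) ⟨
        σ * potential t + (weighted (suc t) + D * last t)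
      ∎)
      where open ≡-Reasoning

    potential≤D*T : ∀ t → potential t ≤ D * T t
    potential≤D*T t = ≤-trans (m≤m+n (potential t) (weighted t)) (≤-reflexive (potential+weighted t))

    potential-contracts : .{{_ : NonZero k}} → ∀ t → D * potential (suc t) ≤ (σ * D ∸ 1) * potential t
    potential-contracts t = begin
        D * potential (suc t)
      ≤⟨ m+n≤o⇒m≤o∸n (D * potential (suc t)) (begin
            D * potential (suc t) + potential t
          ≤⟨ +-monoʳ-≤ (D * potential (suc t))
                (≤-trans (potential≤D*T t) (*-monoʳ-≤ D (m≤n*m (T t) k))) ⟩
            D * potential (suc t) + D * (k * T t)
          ≡⟨ *-distribˡ-+ D (potential (suc t)) (k * T t) ⟨
            D * (potential (suc t) + k * T t)
          ≡⟨ cong (D *_) (potential-step t) ⟩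
            D * (σ * potential t)
          ≡⟨ x∙yz≈yx∙z D σ (potential t) ⟩
            σ * D * potential t
          ∎) ⟩
        σ * D * potential t ∸ potential t
      ≡⟨ cong (σ * D * potential t ∸_) (*-identityˡ (potential t)) ⟨
        σ * D * potential t ∸ 1 * potential t
      ≡⟨ *-distribʳ-∸ (potential t) (σ * D) 1 ⟨
        (σ * D ∸ 1) * potential t
      ∎
      where open ≤-Reasoning

    potential-iterate : .{{_ : NonZero k}} → ∀ t → D ^ t * potential t ≤ (σ * D ∸ 1) ^ t * potential 0
    potential-iterate zero    = ≤-refl
    potential-iterate (suc t) = begin
        D * D ^ t * potential (suc t)
      ≡⟨ xy∙z≈y∙xz D (D ^ t) (potential (suc t)) ⟩
        D ^ t * (D * potential (suc t))
      ≤⟨ *-monoʳ-≤ (D ^ t) (potential-contracts t) ⟩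
        D ^ t * ((σ * D ∸ 1) * potential t)
      ≡⟨ x∙yz≈y∙xz (D ^ t) (σ * D ∸ 1) (potential t) ⟩
        (σ * D ∸ 1) * (D ^ t * potential t)
      ≤⟨ *-monoʳ-≤ (σ * D ∸ 1) (potential-iterate t) ⟩
        (σ * D ∸ 1) * ((σ * D ∸ 1) ^ t * potential 0)
      ≡⟨ *-assoc (σ * D ∸ 1) _ (potential 0) ⟨
        (σ * D ∸ 1) ^ suc t * potential 0
      ∎
      where open ≤-Reasoning

    potential-initial : potential 0 ≤ D
    potential-initial = ≤-trans (potential≤D*T 0)
      (≤-reflexive (trans (cong (λ m → D * suc m) (sum-replicate-zero n)) (*-identityʳ D)))

    k*σ^n*T≤potential : ∀ t → k * σ ^ n * T t ≤ potential t
    k*σ^n*T≤potential t = +-cancelʳ-≤ (σ ^ n * T t) _ _ (begin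
        k * σ ^ n * T t + σ ^ n * T t
      ≡⟨ +-comm (k * σ ^ n * T t) _ ⟩
        σ ^ n * T t + k * σ ^ n * T t
      ≡⟨ *-distribʳ-+ (T t) (σ ^ n) (k * σ ^ n) ⟨
        σ * σ ^ n * T t
      ≡⟨ potential+weighted t ⟨
        potential t + weighted t
      ≤⟨ +-monoʳ-≤ (potential t) (weighted≤ t) ⟩
        potential t + σ ^ n * T t
      ∎)
      where open ≤-Reasoning

    k*w*T≤σ^[1+w] : .{{_ : NonZero k}} → ∀ w → w * (σ * D ∸ 1) ^ w ≤ (σ * D) ^ w →
                    k * (w * T w) ≤ σ * σ ^ w
    k*w*T≤σ^[1+w] w w*[σD∸1]^w≤[σD]^w =
      *-cancelˡ-≤ (D ^ w * σ ^ n) {{m*n≢0 (D ^ w) (σ ^ n) {{m^n≢0 D w}} {{m^n≢0 σ n}}}} (begin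
        D ^ w * σ ^ n * (k * (w * T w))
      ≡⟨ solve 5 (λ a b k w x → a :* b :* (k :* (w :* x)) := w :* (a :* (k :* b :* x)))
               refl (D ^ w) (σ ^ n) k w (T w) ⟩
        w * (D ^ w * (k * σ ^ n * T w))
      ≤⟨ *-monoʳ-≤ w (*-monoʳ-≤ (D ^ w) (k*σ^n*T≤potential w)) ⟩
        w * (D ^ w * potential w)
      ≤⟨ *-monoʳ-≤ w (potential-iterate w) ⟩
        w * ((σ * D ∸ 1) ^ w * potential 0)
      ≤⟨ *-monoʳ-≤ w (*-monoʳ-≤ ((σ * D ∸ 1) ^ w) potential-initial) ⟩
        w * ((σ * D ∸ 1) ^ w * D)
      ≡⟨ *-assoc w ((σ * D ∸ 1) ^ w) D ⟨
        w * (σ * D ∸ 1) ^ w * D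
      ≤⟨ *-monoˡ-≤ D w*[σD∸1]^w≤[σD]^w ⟩
        (σ * D) ^ w * D
      ≡⟨ cong (_* D) (^-distribʳ-* σ D w) ⟩
        σ ^ w * D ^ w * (σ * σ ^ n)
      ≡⟨ solve 4 (λ a b c e → a :* b :* (c :* e) := b :* e :* (c :* a))
               refl (σ ^ w) (D ^ w) σ (σ ^ n) ⟩
        D ^ w * σ ^ n * (σ * σ ^ w)
      ∎)
      where open ≤-Reasoning

  total-bound : .{{_ : NonZero k}} → ∀ d w → LeExp (w ^ (σ ^ suc d)) w → w * total d w ≤ 2 * σ ^ w
  total-bound zero    w _    = ≤-trans (≤-reflexive (*-zeroʳ w)) z≤n
  total-bound (suc n) w lexp = *-cancelˡ-≤ k (begin
      k * (w * T w)
    ≤⟨ k*w*T≤σ^[1+w] w (LeExp⇒w*[m∸1]^w≤m^w (σ * D) w {{m*n≢0 σ D}} lexp) ⟩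
      σ ^ w + k * σ ^ w
    ≤⟨ +-monoˡ-≤ (k * σ ^ w) (m≤n*m (σ ^ w) k) ⟩
      k * σ ^ w + k * σ ^ w
    ≡⟨ solve 2 (λ k x → k :* x :+ k :* x := k :* (con 2 :* x)) refl k (σ ^ w) ⟩
      k * (2 * σ ^ w)
    ∎)
    where
      open ≤-Reasoning
      open Potential n

open import Defs
open import Data.Nat using (ℕ; _≤_)
open import Data.Nat as ℕ using (zero; suc; s≤s)
import Data.Nat.Properties as ℕP
open import Data.Nat.Coprimality as Coprimality using (1-coprimeTo)
import Data.Integer as ℤ
import Data.Integer.Properties as ℤP
open import Data.Rational using (ℚ; mkℚ; 0ℚ; 1ℚ; _+_; _*_; _-_; ∣_∣)
open import Data.Rational as ℚ using ()
import Data.Rational.Properties as ℚP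
open import Data.Rational.Solver using (module +-*-Solver)
open +-*-Solver
open import Data.Fin using (Fin; zero; suc; toℕ; inject₁)
open import Data.Fin.Properties using (toℕ-inject₁; toℕ-injective; suc-injective)
open import Data.Product using (∃-syntax; _,_)
open import Function using (_∘_)
open import Algebra.Bundles using (CommutativeMonoid)
open import Algebra.Definitions.RawSemiring ℚ.+-*-rawSemiring using (_^_)
open import Algebra.Properties.Semiring.Sum ℕP.+-*-semiring using (sum)
open import Algebra.Properties.CommutativeSemigroup
  (CommutativeMonoid.commutativeSemigroup ℚP.*-1-commutativeMonoid)
  using (x∙yz≈y∙xz; xy∙z≈zx∙y; xy∙z≈x∙zy)
open import Relation.Binary.PropositionalEquality
open import Relation.Nullary using (yes; no; contradiction)

ℕ→ℚ≡mkℚ : ∀ n → ℕ→ℚ n ≡ mkℚ (ℤ.+ n) 0 (Coprimality.sym (1-coprimeTo n))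
ℕ→ℚ≡mkℚ n = ℚP.normalize-coprime _

ℕ→ℚ-+ : ∀ m n → ℕ→ℚ (m ℕ.+ n) ≡ ℕ→ℚ m + ℕ→ℚ n
ℕ→ℚ-+ m n rewrite ℕ→ℚ≡mkℚ m | ℕ→ℚ≡mkℚ n =
  cong (ℚ._/ 1) (cong₂ ℤ._+_ (sym (ℤP.*-identityʳ (ℤ.+ m))) (sym (ℤP.*-identityʳ (ℤ.+ n))))

ℕ→ℚ-* : ∀ m n → ℕ→ℚ (m ℕ.* n) ≡ ℕ→ℚ m * ℕ→ℚ n
ℕ→ℚ-* m n rewrite ℕ→ℚ≡mkℚ m | ℕ→ℚ≡mkℚ n = cong (ℚ._/ 1) (ℤP.pos-* m n)

ℕ→ℚ-mono-≤ : ∀ {m n} → m ≤ n → ℕ→ℚ m ℚ.≤ ℕ→ℚ n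
ℕ→ℚ-mono-≤ {m} {n} m≤n rewrite ℕ→ℚ≡mkℚ m | ℕ→ℚ≡mkℚ n =
  ℚ.*≤* (ℤP.*-monoʳ-≤-nonNeg (ℤ.+ 1) (ℤ.+≤+ m≤n))

μ*σ≡1 : ∀ σ .{{_ : ℕ.NonZero σ}} → μ σ * ℕ→ℚ σ ≡ 1ℚ
μ*σ≡1 (suc k) rewrite ℕ→ℚ≡mkℚ (suc k) =
  trans (cong (_* σ) (ℚP.normalize-coprime (1-coprimeTo (suc k)))) (ℚP.*-inverseˡ σ)
  where σ = mkℚ (ℤ.+ suc k) 0 (Coprimality.sym (1-coprimeTo (suc k)))

1-μ≡k*μ : ∀ k → 1ℚ - μ (suc k) ≡ ℕ→ℚ k * μ (suc k)
1-μ≡k*μ k = begin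
    1ℚ - μ (suc k)
  ≡⟨ cong (_- μ (suc k)) (trans (sym (μ*σ≡1 (suc k))) (cong (μ (suc k) *_) (ℕ→ℚ-+ 1 k))) ⟩
    μ (suc k) * (1ℚ + ℕ→ℚ k) - μ (suc k)
  ≡⟨ solve 2 (λ m x → m :* (con 1ℚ :+ x) :- m := x :* m) refl (μ (suc k)) (ℕ→ℚ k) ⟩
    ℕ→ℚ k * μ (suc k)
  ∎
  where open ≡-Reasoning

μ^t*σ^t≡1 : ∀ σ .{{_ : ℕ.NonZero σ}} t → μ σ ^ t * ℕ→ℚ (σ ℕ.^ t) ≡ 1ℚ
μ^t*σ^t≡1 σ zero    = refl
μ^t*σ^t≡1 σ (suc t) = begin
    μ σ * μ σ ^ t * ℕ→ℚ (σ ℕ.* σ ℕ.^ t)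
  ≡⟨ cong (μ σ * μ σ ^ t *_) (ℕ→ℚ-* σ (σ ℕ.^ t)) ⟩
    μ σ * μ σ ^ t * (ℕ→ℚ σ * ℕ→ℚ (σ ℕ.^ t))
  ≡⟨ solve 4 (λ a b c e → a :* b :* (c :* e) := a :* c :* (b :* e))
           refl (μ σ) (μ σ ^ t) (ℕ→ℚ σ) (ℕ→ℚ (σ ℕ.^ t)) ⟩
    μ σ * ℕ→ℚ σ * (μ σ ^ t * ℕ→ℚ (σ ℕ.^ t))
  ≡⟨ cong₂ _*_ (μ*σ≡1 σ) (μ^t*σ^t≡1 σ t) ⟩
    1ℚ
  ∎
  where open ≡-Reasoning

ℕ→ℚ-nonNeg : ∀ n → ℚ.NonNegative (ℕ→ℚ n)
ℕ→ℚ-nonNeg n = ℚP.normalize-nonNeg n 1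

μ-nonNeg : ∀ σ → ℚ.NonNegative (μ σ)
μ-nonNeg zero    = _
μ-nonNeg (suc k) = ℚP.normalize-nonNeg 1 (suc k)

μ^t-nonNeg : ∀ σ t → ℚ.NonNegative (μ σ ^ t)
μ^t-nonNeg σ zero    = _
μ^t-nonNeg σ (suc t) = ℚP.nonNeg*nonNeg⇒nonNeg (μ σ) {{μ-nonNeg σ}} (μ σ ^ t) {{μ^t-nonNeg σ t}}

sumFin-cong : ∀ d {f g : Fin d → ℚ} → (∀ i → f i ≡ g i) → sumFin d f ≡ sumFin d g
sumFin-cong zero    f≗g = refl
sumFin-cong (suc d) f≗g = cong₂ _+_ (f≗g zero) (sumFin-cong d (λ i → f≗g (suc i)))

sumFin-zero : ∀ d {f : Fin d → ℚ} → (∀ i → f i ≡ 0ℚ) → sumFin d f ≡ 0ℚ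
sumFin-zero zero    f≗0 = refl
sumFin-zero (suc d) f≗0 = cong₂ _+_ (f≗0 zero) (sumFin-zero d (λ i → f≗0 (suc i)))

sumFin-single : ∀ d (j : Fin d) {f : Fin d → ℚ} → (∀ i → i ≢ j → f i ≡ 0ℚ) → sumFin d f ≡ f j
sumFin-single (suc d) zero {f} f≗0 =
  trans (cong (f zero +_) (sumFin-zero d (λ i → f≗0 (suc i) (λ ())))) (ℚP.+-identityʳ (f zero))
sumFin-single (suc d) (suc j) {f} f≗0 =
  trans (cong₂ _+_ (f≗0 zero (λ ()))
                   (sumFin-single d j (λ i i≢j → f≗0 (suc i) (i≢j ∘ suc-injective))))
        (ℚP.+-identityˡ (f (suc j)))

sumFin-ℕ→ℚ-* : ∀ d (f : Fin d → ℕ) c → sumFin d (λ i → ℕ→ℚ (f i) * c) ≡ ℕ→ℚ (sum f) * c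
sumFin-ℕ→ℚ-* zero    f c = sym (ℚP.*-zeroˡ c)
sumFin-ℕ→ℚ-* (suc d) f c = begin
    ℕ→ℚ (f zero) * c + sumFin d (λ i → ℕ→ℚ (f (suc i)) * c)
  ≡⟨ cong (ℕ→ℚ (f zero) * c +_) (sumFin-ℕ→ℚ-* d (λ i → f (suc i)) c) ⟩
    ℕ→ℚ (f zero) * c + ℕ→ℚ (sum (λ i → f (suc i))) * c
  ≡⟨ ℚP.*-distribʳ-+ c (ℕ→ℚ (f zero)) _ ⟨
    (ℕ→ℚ (f zero) + ℕ→ℚ (sum (λ i → f (suc i)))) * c
  ≡⟨ cong (_* c) (ℕ→ℚ-+ (f zero) _) ⟨
    ℕ→ℚ (sum f) * c
  ∎
  where open ≡-Reasoning

A-subdiagonal : ∀ σ n (i : Fin n) → A σ (suc n) (suc i) (inject₁ i) ≡ μ σ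
A-subdiagonal σ n i with toℕ i ℕ.≟ toℕ (inject₁ i)
... | yes _  = refl
... | no  i≢ = contradiction (sym (toℕ-inject₁ i)) i≢

A-off-subdiagonal : ∀ σ n (i : Fin n) j → j ≢ inject₁ i → A σ (suc n) (suc i) j ≡ 0ℚ
A-off-subdiagonal σ n i j j≢i with toℕ i ℕ.≟ toℕ j
... | yes i≡j = contradiction (toℕ-injective (sym (trans (toℕ-inject₁ i) i≡j))) j≢i
... | no  _   = refl

A·ᵥ-suc : ∀ σ n (v : Fin (suc n) → ℚ) (i : Fin n) →
          (A σ (suc n) ·ᵥ v) (suc i) ≡ μ σ * v (inject₁ i)
A·ᵥ-suc σ n v i = trans
  (sumFin-single (suc n) (inject₁ i)
    (λ j j≢i → trans (cong (_* v j) (A-off-subdiagonal σ n i j j≢i)) (ℚP.*-zeroˡ (v j))))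
  (cong (_* v (inject₁ i)) (A-subdiagonal σ n i))

module _ (k : ℕ) where

  open ZeroRuns k using (σ; runs; total; total-bound)

  A^t·p₀≡runs*μ^t : ∀ {d} t (i : Fin d) →
                    pow·ᵥ (A σ d) t (p₀ d) i ≡ ℕ→ℚ (runs t i) * μ σ ^ t
  A^t·p₀≡runs*μ^t zero    zero    = sym (ℚP.*-identityʳ 1ℚ)
  A^t·p₀≡runs*μ^t zero    (suc i) = sym (ℚP.*-zeroˡ 1ℚ)
  A^t·p₀≡runs*μ^t {suc n} (suc t) zero = begin
      sumFin (suc n) (λ j → (1ℚ - μ σ) * pow·ᵥ (A σ (suc n)) t (p₀ (suc n)) j)
    ≡⟨ sumFin-cong (suc n) (λ j → trans (cong ((1ℚ - μ σ) *_) (A^t·p₀≡runs*μ^t t j))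
                                         (x∙yz≈y∙xz (1ℚ - μ σ) (ℕ→ℚ (runs t j)) (μ σ ^ t))) ⟩
      sumFin (suc n) (λ j → ℕ→ℚ (runs t j) * ((1ℚ - μ σ) * μ σ ^ t))
    ≡⟨ sumFin-ℕ→ℚ-* (suc n) (runs t) ((1ℚ - μ σ) * μ σ ^ t) ⟩
      ℕ→ℚ (total (suc n) t) * ((1ℚ - μ σ) * μ σ ^ t)
    ≡⟨ cong (λ x → ℕ→ℚ (total (suc n) t) * (x * μ σ ^ t)) (1-μ≡k*μ k) ⟩
      ℕ→ℚ (total (suc n) t) * (ℕ→ℚ k * μ σ * μ σ ^ t)
    ≡⟨ solve 4 (λ T k m mᵗ → T :* (k :* m :* mᵗ) := k :* T :* (m :* mᵗ))
             refl (ℕ→ℚ (total (suc n) t)) (ℕ→ℚ k) (μ σ) (μ σ ^ t) ⟩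
      ℕ→ℚ k * ℕ→ℚ (total (suc n) t) * μ σ ^ suc t
    ≡⟨ cong (_* μ σ ^ suc t) (ℕ→ℚ-* k (total (suc n) t)) ⟨
      ℕ→ℚ (runs (suc t) zero) * μ σ ^ suc t
    ∎
    where open ≡-Reasoning
  A^t·p₀≡runs*μ^t {suc n} (suc t) (suc i) = begin
      (A σ (suc n) ·ᵥ pow·ᵥ (A σ (suc n)) t (p₀ (suc n))) (suc i)
    ≡⟨ A·ᵥ-suc σ n (pow·ᵥ (A σ (suc n)) t (p₀ (suc n))) i ⟩
      μ σ * pow·ᵥ (A σ (suc n)) t (p₀ (suc n)) (inject₁ i)
    ≡⟨ cong (μ σ *_) (A^t·p₀≡runs*μ^t t (inject₁ i)) ⟩
      μ σ * (ℕ→ℚ (runs t (inject₁ i)) * μ σ ^ t)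
    ≡⟨ x∙yz≈y∙xz (μ σ) (ℕ→ℚ (runs t (inject₁ i))) (μ σ ^ t) ⟩
      ℕ→ℚ (runs (suc t) (suc i)) * μ σ ^ suc t
    ∎
    where open ≡-Reasoning

  ‖A^t·p₀‖₁≡total*μ^t : ∀ d t → ‖ pow·ᵥ (A σ d) t (p₀ d) ‖₁ ≡ ℕ→ℚ (total d t) * μ σ ^ t
  ‖A^t·p₀‖₁≡total*μ^t d t = trans
    (sumFin-cong d (λ i → trans (cong ∣_∣ (A^t·p₀≡runs*μ^t t i))
                                (ℚP.0≤p⇒∣p∣≡p (ℚP.nonNegative⁻¹ _ {{nonNeg-runs*μ^t i}}))))
    (sumFin-ℕ→ℚ-* d (runs t) (μ σ ^ t))
    where
      nonNeg-runs*μ^t : ∀ i → ℚ.NonNegative (ℕ→ℚ (runs t i) * μ σ ^ t)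
      nonNeg-runs*μ^t i =
        ℚP.nonNeg*nonNeg⇒nonNeg (ℕ→ℚ (runs t i)) {{ℕ→ℚ-nonNeg (runs t i)}} (μ σ ^ t) {{μ^t-nonNeg σ t}}

  ‖A^w·p₀‖₁*w≤2 : .{{_ : ℕ.NonZero k}} → ∀ d w → LeExp (w ℕ.^ (σ ℕ.^ suc d)) w →
                  ‖ pow·ᵥ (A σ d) w (p₀ d) ‖₁ * ℕ→ℚ w ℚ.≤ ℕ→ℚ 2
  ‖A^w·p₀‖₁*w≤2 d w w^σ^[1+d]≤eʷ = begin
      ‖ pow·ᵥ (A σ d) w (p₀ d) ‖₁ * ℕ→ℚ w
    ≡⟨ cong (_* ℕ→ℚ w) (‖A^t·p₀‖₁≡total*μ^t d w) ⟩
      ℕ→ℚ (total d w) * μʷ * ℕ→ℚ w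
    ≡⟨ xy∙z≈zx∙y (ℕ→ℚ (total d w)) μʷ (ℕ→ℚ w) ⟩
      ℕ→ℚ w * ℕ→ℚ (total d w) * μʷ
    ≡⟨ cong (_* μʷ) (ℕ→ℚ-* w (total d w)) ⟨
      ℕ→ℚ (w ℕ.* total d w) * μʷ
    ≤⟨ ℚP.*-monoʳ-≤-nonNeg μʷ {{μ^t-nonNeg σ w}} (ℕ→ℚ-mono-≤ (total-bound d w w^σ^[1+d]≤eʷ)) ⟩
      ℕ→ℚ (2 ℕ.* σ ℕ.^ w) * μʷ
    ≡⟨ cong (_* μʷ) (ℕ→ℚ-* 2 (σ ℕ.^ w)) ⟩
      ℕ→ℚ 2 * ℕ→ℚ (σ ℕ.^ w) * μʷ
    ≡⟨ xy∙z≈x∙zy (ℕ→ℚ 2) (ℕ→ℚ (σ ℕ.^ w)) μʷ ⟩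
      ℕ→ℚ 2 * (μʷ * ℕ→ℚ (σ ℕ.^ w))
    ≡⟨ cong (ℕ→ℚ 2 *_) (μ^t*σ^t≡1 σ w) ⟩
      ℕ→ℚ 2 * 1ℚ
    ≡⟨ ℚP.*-identityʳ (ℕ→ℚ 2) ⟩
      ℕ→ℚ 2
    ∎
    where
      open ℚP.≤-Reasoning
      μʷ = μ σ ^ w

lemma7 : (σ : ℕ) → 2 ≤ σ →
         ∃[ C ] ∃[ W ] ((w d : ℕ) → W ≤ w → IsD σ w d →
           (‖ pow·ᵥ (A σ d) w (p₀ d) ‖₁ * ℕ→ℚ w) ℚ.≤ C)
lemma7 (suc (suc s)) (s≤s (s≤s _)) =
  ℕ→ℚ 2 , 0 , λ w d _ (w^σ^[1+d]≤eʷ , _) → ‖A^w·p₀‖₁*w≤2 (suc s) d w w^σ^[1+d]≤eʷ
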